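{- Let $A\in\mathcal{A}_n$ be a binary matrix whose diagonal entries are all $1$. Then for every cell $(i,j)$, $1\le i,j\le n$, \[ 1_{\mathrm{UR}}(i,j)\,0_{\mathrm{LL}}(i,j)\le 2n^4\,\Gamma_1(A). \]
   Context: For a positive integer $n$, $\mathcal{A}_n$ denotes the set of all symmetric $n\times n$ real matrices with entries in $[0,1]$; a matrix is binary if its entries lie in $\{0,1\}$. For $1\le a\le b\le n$ define $\mathrm{UR}(a,b)=\{(i,j): 1\le i<a,\ b<j\le n\}$ and $\mathrm{LL}(a,b)=\{(i,j): a\le i\le j\le b\}$; for a binary matrix $A$ let $1_{\mathrm{UR}}(a,b)$ be the number of cells of $\mathrm{UR}(a,b)$ where $A$ equals $1$ and $0_{\mathrm{LL}}(a,b)$ the number of cells of $\mathrm{LL}(a,b)$ where $A$ equals $0$; by convention $1_{\mathrm{UR}}(a,b)=0_{\mathrm{LL}}(a,b)=0$ when $a>b$. For $x\in\mathbb{R}$ let $[x]_+=\max(x,0)$, and \[ \Gamma_1(A)=\frac{1}{n^3}\sum_{1\le i<k<j\le n}\Big([A_{i,j}-A_{i,k}]_+ + [A_{i,j}-A_{k,j}]_+\Big). \] -}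

module Defs where

open import Data.Bool using (Bool; true; false; if_then_else_; _∧_)
open import Data.Nat using (ℕ; _+_; _*_; _∸_; _<ᵇ_; _≤ᵇ_; _>_)
open import Data.Fin using (Fin; toℕ)
open import Data.List using (List; map; allFin)
open import Data.Nat.ListAction using (sum)
open import Relation.Binary.PropositionalEquality using (_≡_)
open import Relation.Nullary.Decidable using (does)

-- A binary n×n matrix: entries in {0,1}, encoded as Bool (true = 1).
BinMatrix : ℕ → Set
BinMatrix n = Fin n → Fin n → Bool

val : Bool → ℕ
val b = if b then 1 else 0

Symmetric : ∀ {n} → BinMatrix n → Set
Symmetric {n} A = ∀ (i j : Fin n) → A i j ≡ A j i

DiagOne : ∀ {n} → BinMatrix n → Set
DiagOne {n} A = ∀ (i : Fin n) → A i i ≡ true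

Σ[_] : ∀ n → (Fin n → ℕ) → ℕ
Σ[ n ] f = sum (map f (allFin n))

[_] : Bool → ℕ
[ b ] = val b

-- Indices are 0-based (Fin n); comparisons via toℕ are the same as the 1-based ones.
-- 1_UR(a,b): number of cells (p,q), p < a, b < q, with A p q = 1; 0 when a > b.
oneUR : ∀ {n} → BinMatrix n → Fin n → Fin n → ℕ
oneUR {n} A a b =
  if toℕ b <ᵇ toℕ a then 0 else
  Σ[ n ] λ p → Σ[ n ] λ q →
    [ (toℕ p <ᵇ toℕ a) ∧ (toℕ b <ᵇ toℕ q) ] * val (A p q)

zeroLL : ∀ {n} → BinMatrix n → Fin n → Fin n → ℕ
zeroLL {n} A a b =
  if toℕ b <ᵇ toℕ a then 0 else
  Σ[ n ] λ p → Σ[ n ] λ q →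
    [ (toℕ a ≤ᵇ toℕ p) ∧ ((toℕ p ≤ᵇ toℕ q) ∧ (toℕ q ≤ᵇ toℕ b)) ] * (1 ∸ val (A p q))

-- n^3 · Γ_1(A) = Σ_{i<k<j} ([A_ij - A_ik]_+ + [A_ij - A_kj]_+).
-- For 0/1 entries, [x - y]_+ is exactly truncated subtraction x ∸ y.
Γ₁num : ∀ {n} → BinMatrix n → ℕ
Γ₁num {n} A =
  Σ[ n ] λ i → Σ[ n ] λ k → Σ[ n ] λ j →
    [ (toℕ i <ᵇ toℕ k) ∧ (toℕ k <ᵇ toℕ j) ] *
      ((val (A i j) ∸ val (A i k)) + (val (A i j) ∸ val (A k j)))

module Submission where

-- Fix a cell (a,b) with a ≤ b.  Pair a 1-cell (p,q) of UR(a,b)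
-- (so p < a ≤ b < q) with a 0-cell (r,s) of LL(a,b) (so a ≤ r ≤ s ≤ b).  As
-- the diagonal is 1 we get r < s, hence p < r < s < q, and the triple terms of
-- Γ₁ detect a violation: if A p s = 0 the row term [A p q - A p s]₊ of the
-- triple (p,s,q) equals 1, and if A p s = 1 the column term [A p s - A r s]₊
-- of the triple (p,r,s) equals 1 ("charging").  Summing over all such pairs,
-- 1_UR · 0_LL is at most the sum of these charges; a row term of (p,s,q) is
-- charged once for each r, a column term of (p,r,s) once for each q, so the
-- total is at most n · n³Γ₁(A).  This is even stronger than the claimed 2n·n³Γ₁.

open import Defs
open import Data.Nat using (ℕ; zero; suc; _+_; _*_; _∸_; _≤_; _<_; _<ᵇ_; _≤ᵇ_; z≤n; s≤s)
open import Data.Nat.Properties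
  using (+-*-semiring; +-mono-≤; *-distribˡ-+; *-monoˡ-≤; m≤m+n; <⇒<ᵇ; <ᵇ⇒<; ≤ᵇ⇒≤;
         ≤∧≢⇒<; <-trans; <-≤-trans; ≤-<-trans; module ≤-Reasoning)
open import Data.Fin using (Fin; toℕ) renaming (zero to fzero; suc to fsuc)
open import Data.Fin.Properties using (toℕ-injective)
open import Data.Bool using (true; false; T; _∧_)
open import Data.Bool.Properties using (T-≡; T-∧)
open import Data.Product using (_,_)
open import Data.List using (map; tabulate)
open import Data.Nat.ListAction using (sum)
open import Function using (_∘_; Equivalence)
open import Relation.Binary.PropositionalEquality
  using (_≡_; _≢_; refl; sym; trans; cong; cong₂; module ≡-Reasoning)
open import Algebra.Properties.Semiring.Sum +-*-semiring
  using (∑-distrib-+; ∑-comm; *-distribˡ-sum; *-distribʳ-sum; sum-cong-≗)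
  renaming (sum to ∑)

open Equivalence using (to)

sum-map-tabulate : ∀ {X : Set} n (g : Fin n → X) (f : X → ℕ) →
  sum (map f (tabulate g)) ≡ ∑ (f ∘ g)
sum-map-tabulate zero    g f = refl
sum-map-tabulate (suc n) g f = cong (f (g fzero) +_) (sum-map-tabulate n (g ∘ fsuc) f)

Σ≡∑ : ∀ n (f : Fin n → ℕ) → Σ[ n ] f ≡ ∑ f
Σ≡∑ n f = sum-map-tabulate n (λ i → i) f

Σ²≡∑² : ∀ n (f : Fin n → Fin n → ℕ) → (Σ[ n ] λ p → Σ[ n ] (f p)) ≡ ∑ λ p → ∑ (f p)
Σ²≡∑² n f = trans (Σ≡∑ n (λ p → Σ[ n ] (f p))) (sum-cong-≗ λ p → Σ≡∑ n (f p))

Σ³≡∑³ : ∀ n (f : Fin n → Fin n → Fin n → ℕ) →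
  (Σ[ n ] λ i → Σ[ n ] λ k → Σ[ n ] (f i k)) ≡ ∑ λ i → ∑ λ k → ∑ (f i k)
Σ³≡∑³ n f = trans (Σ≡∑ n _) (sum-cong-≗ λ i → Σ²≡∑² n (f i))

∑-const : ∀ n (c : ℕ) → ∑ {n} (λ _ → c) ≡ n * c
∑-const zero    c = refl
∑-const (suc n) c = cong (c +_) (∑-const n c)

∑-mono : ∀ n {f g : Fin n → ℕ} → (∀ i → f i ≤ g i) → ∑ f ≤ ∑ g
∑-mono zero    f≤g = z≤n
∑-mono (suc n) f≤g = +-mono-≤ (f≤g fzero) (∑-mono n (f≤g ∘ fsuc))

∑-*-∑ : ∀ {m n} (f : Fin m → ℕ) (g : Fin n → ℕ) → ∑ f * ∑ g ≡ ∑ λ i → ∑ λ j → f i * g j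
∑-*-∑ f g = trans (*-distribʳ-sum (∑ g) f) (sum-cong-≗ λ i → *-distribˡ-sum (f i) g)

∑∑-*-∑∑ : ∀ {n} (f g : Fin n → Fin n → ℕ) →
  (∑ λ p → ∑ λ q → f p q) * (∑ λ r → ∑ λ s → g r s)
    ≡ ∑ λ p → ∑ λ r → ∑ λ q → ∑ λ s → f p q * g r s
∑∑-*-∑∑ f g = trans (∑-*-∑ (∑ ∘ f) (∑ ∘ g))
  (sum-cong-≗ λ p → sum-cong-≗ λ r → ∑-*-∑ (f p) (g r))

charge-count : ∀ n (f g : Fin n → Fin n → ℕ) →
  (∑ λ r → ∑ λ q → ∑ λ s → f s q + g r s) ≡ n * ∑ λ k → ∑ λ j → f k j + g k j
charge-count n f g = begin
  (∑ λ r → ∑ λ q → ∑ λ s → f s q + g r s)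
    ≡⟨ sum-cong-≗ (λ r → trans (sum-cong-≗ λ q → ∑-distrib-+ (λ s → f s q) (g r))
                               (∑-distrib-+ (λ q → ∑ λ s → f s q) (λ _ → ∑ (g r)))) ⟩
  (∑ λ r → F + ∑ {n} λ _ → ∑ (g r))
    ≡⟨ ∑-distrib-+ (λ _ → F) (λ r → ∑ {n} λ _ → ∑ (g r)) ⟩
  (∑ {n} λ _ → F) + (∑ λ r → ∑ {n} λ _ → ∑ (g r))
    ≡⟨ cong₂ _+_ (∑-const n F) (trans (sum-cong-≗ λ r → ∑-const n (∑ (g r)))
                                      (sym (*-distribˡ-sum n (∑ ∘ g)))) ⟩
  n * F + n * (∑ λ r → ∑ λ s → g r s)
    ≡⟨ sym (*-distribˡ-+ n F (∑ (∑ ∘ g))) ⟩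
  n * (F + ∑ λ r → ∑ λ s → g r s)
    ≡⟨ cong (λ x → n * (x + ∑ (∑ ∘ g))) (∑-comm (λ q s → f s q)) ⟩
  n * ((∑ λ k → ∑ λ j → f k j) + ∑ λ k → ∑ λ j → g k j)
    ≡⟨ cong (n *_) (sym (trans (sum-cong-≗ λ k → ∑-distrib-+ (f k) (g k))
                                 (∑-distrib-+ (∑ ∘ f) (∑ ∘ g)))) ⟩
  n * (∑ λ k → ∑ λ j → f k j + g k j) ∎
  where
  open ≡-Reasoning
  F : ℕ
  F = ∑ λ q → ∑ λ s → f s q

ordered-indicator : ∀ {x y z} → x < y → y < z → [ (x <ᵇ y) ∧ (y <ᵇ z) ] ≡ 1
ordered-indicator x<y y<z =
  cong₂ (λ u v → [ u ∧ v ]) (to T-≡ (<⇒<ᵇ x<y)) (to T-≡ (<⇒<ᵇ y<z))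

indicator-product-bound : ∀ c₁ d₁ c₂ d₂ y →
  (T c₁ → d₁ ≡ true → T c₂ → d₂ ≡ false → 1 ≤ y) →
  ([ c₁ ] * val d₁) * ([ c₂ ] * (1 ∸ val d₂)) ≤ y
indicator-product-bound true  true  true  false y one≤y = one≤y _ refl _ refl
indicator-product-bound true  true  true  true  y one≤y = z≤n
indicator-product-bound true  true  false d₂    y one≤y = z≤n
indicator-product-bound true  false c₂    d₂    y one≤y = z≤n
indicator-product-bound false d₁    c₂    d₂    y one≤y = z≤n

module _ {n : ℕ} (A : BinMatrix n) where

  rowIncrease colIncrease : Fin n → Fin n → Fin n → ℕ
  rowIncrease i k j = [ (toℕ i <ᵇ toℕ k) ∧ (toℕ k <ᵇ toℕ j) ] * (val (A i j) ∸ val (A i k))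
  colIncrease i k j = [ (toℕ i <ᵇ toℕ k) ∧ (toℕ k <ᵇ toℕ j) ] * (val (A i j) ∸ val (A k j))

  Γ₁-split : Γ₁num A ≡ ∑ λ i → ∑ λ k → ∑ λ j → rowIncrease i k j + colIncrease i k j
  Γ₁-split = trans (Σ³≡∑³ n summand) (sum-cong-≗ λ i → sum-cong-≗ λ k → sum-cong-≗ λ j →
    *-distribˡ-+ (ordered i k j) (val (A i j) ∸ val (A i k)) (val (A i j) ∸ val (A k j)))
    where
    ordered : Fin n → Fin n → Fin n → ℕ
    ordered i k j = [ (toℕ i <ᵇ toℕ k) ∧ (toℕ k <ᵇ toℕ j) ]
    summand : Fin n → Fin n → Fin n → ℕ
    summand i k j = ordered i k j * ((val (A i j) ∸ val (A i k)) + (val (A i j) ∸ val (A k j)))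

  zero-off-diagonal : DiagOne A → ∀ {r s} → A r s ≡ false → toℕ r ≢ toℕ s
  zero-off-diagonal diag {r} {s} Ars r≡s with toℕ-injective r≡s
  ... | refl with trans (sym Ars) (diag r)
  ... | ()

  -- Charging: for p < r < s < q with A p q = 1 and A r s = 0, one of the triples
  -- p < s < q (row) or p < r < s (column) carries a violation, according to A p s.
  charge : ∀ {p q r s} → toℕ p < toℕ r → toℕ r < toℕ s → toℕ s < toℕ q →
    A p q ≡ true → A r s ≡ false → 1 ≤ rowIncrease p s q + colIncrease p r s
  charge {p} {q} {r} {s} p<r r<s s<q Apq Ars
    rewrite ordered-indicator (<-trans p<r r<s) s<q | ordered-indicator p<r r<s | Apq | Ars
    with A p s
  ... | true  = s≤s z≤n
  ... | false = s≤s z≤n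

  urOne llZero : Fin n → Fin n → Fin n → Fin n → ℕ
  urOne  a b p q = [ (toℕ p <ᵇ toℕ a) ∧ (toℕ b <ᵇ toℕ q) ] * val (A p q)
  llZero a b r s = [ (toℕ a ≤ᵇ toℕ r) ∧ ((toℕ r ≤ᵇ toℕ s) ∧ (toℕ s ≤ᵇ toℕ b)) ] * (1 ∸ val (A r s))

  pair-charge : DiagOne A → ∀ a b p q r s →
    urOne a b p q * llZero a b r s ≤ rowIncrease p s q + colIncrease p r s
  pair-charge diag a b p q r s = indicator-product-bound _ (A p q) _ (A r s) _ charged
    where
    charged : T ((toℕ p <ᵇ toℕ a) ∧ (toℕ b <ᵇ toℕ q)) → A p q ≡ true →
      T ((toℕ a ≤ᵇ toℕ r) ∧ ((toℕ r ≤ᵇ toℕ s) ∧ (toℕ s ≤ᵇ toℕ b))) → A r s ≡ false →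
      1 ≤ rowIncrease p s q + colIncrease p r s
    charged inUR Apq inLL Ars with to T-∧ inUR | to T-∧ inLL
    ... | p<a , b<q | a≤r , r≤s∧s≤b with to T-∧ r≤s∧s≤b
    ... | r≤s , s≤b =
      charge (<-≤-trans (<ᵇ⇒< (toℕ p) (toℕ a) p<a) (≤ᵇ⇒≤ (toℕ a) (toℕ r) a≤r))
        (≤∧≢⇒< (≤ᵇ⇒≤ (toℕ r) (toℕ s) r≤s) (zero-off-diagonal diag Ars))
        (≤-<-trans (≤ᵇ⇒≤ (toℕ s) (toℕ b) s≤b) (<ᵇ⇒< (toℕ b) (toℕ q) b<q)) Apq Ars

  total-charge :
    (∑ λ p → ∑ λ r → ∑ λ q → ∑ λ s → rowIncrease p s q + colIncrease p r s)
      ≡ n * ∑ λ i → ∑ λ k → ∑ λ j → rowIncrease i k j + colIncrease i k j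
  total-charge = trans (sum-cong-≗ λ p → charge-count n (rowIncrease p) (colIncrease p))
                       (sym (*-distribˡ-sum n λ i → ∑ λ k → ∑ λ j →
                                                rowIncrease i k j + colIncrease i k j))

-- Lemma 3.2, via the sharper bound 1_UR · 0_LL ≤ n · n³Γ₁(A).
lemma3p2 : (n : ℕ) (A : BinMatrix n) → Symmetric A → DiagOne A →
    (i j : Fin n) → oneUR A i j * zeroLL A i j ≤ 2 * n * Γ₁num A
lemma3p2 n A _ diag a b with toℕ b <ᵇ toℕ a
... | true  = z≤n
... | false = begin
  (Σ[ n ] λ p → Σ[ n ] (urOne A a b p)) * (Σ[ n ] λ r → Σ[ n ] (llZero A a b r))
    ≡⟨ cong₂ _*_ (Σ²≡∑² n (urOne A a b)) (Σ²≡∑² n (llZero A a b)) ⟩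
  (∑ λ p → ∑ (urOne A a b p)) * (∑ λ r → ∑ (llZero A a b r))
    ≡⟨ ∑∑-*-∑∑ (urOne A a b) (llZero A a b) ⟩
  (∑ λ p → ∑ λ r → ∑ λ q → ∑ λ s → urOne A a b p q * llZero A a b r s)
    ≤⟨ ∑-mono n (λ p → ∑-mono n λ r → ∑-mono n λ q → ∑-mono n λ s →
         pair-charge A diag a b p q r s) ⟩
  (∑ λ p → ∑ λ r → ∑ λ q → ∑ λ s → rowIncrease A p s q + colIncrease A p r s)
    ≡⟨ trans (total-charge A) (cong (n *_) (sym (Γ₁-split A))) ⟩
  n * Γ₁num A
    ≤⟨ *-monoˡ-≤ (Γ₁num A) (m≤m+n n (n + 0)) ⟩
  2 * n * Γ₁num A ∎
  where open ≤-Reasoning
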